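{- Let $G$ be a connected circle graph with a split $A, B, \mathfrak{s}(A), \mathfrak{s}(B)$. Let $x, y \in A$ be connected by a path in $G$ that has at least one internal vertex and all of whose internal vertices lie in $\mathfrak{s}(A)$. Then in every circle representation $\mathcal{R}$ of $G$, with $\gamma = \gamma_1\cdots\gamma_{2k}$ as defined below, there is an index $i$ such that both $x$ and $y$ belong to $\gamma_i$ and both belong to $\gamma_{i+k}$.
   Context: A circle representation of a graph $G$ assigns to each vertex $v$ a chord $C_v$ of a fixed circle, all endpoints being distinct, such that $C_u \cap C_v \neq \emptyset$ iff $uv \in E(G)$. Its circular word $\tau$ lists the endpoints around the circle, labelled by their vertices; each vertex occurs twice, and $uv\in E(G)$ iff their occurrences alternate. A split of a connected graph $G$ is a partition of $V(G)$ into $A, B, \mathfrak{s}(A), \mathfrak{s}(B)$ such that every $a \in A$ is adjacent to every $b \in B$; there is no edge between $\mathfrak{s}(A)$ and $B \cup \mathfrak{s}(B)$, nor between $\mathfrak{s}(B)$ and $A \cup \mathfrak{s}(A)$; and $|A\cup\mathfrak{s}(A)|\ge 2$, $|B \cup \mathfrak{s}(B)|\ge 2$. Given a representation with circular word $\tau$, let $\gamma$ be the circular subsequence of $\tau$ induced by $A\cup B$, and write $\gamma=\gamma_1\cdots\gamma_{2k}$ where the $\gamma_i$ are, in circular order, the maximal subwords consisting only of symbols of $A$ or only of symbols of $B$ (so $A$-words and $B$-words alternate); indices are modulo $2k$. -}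

module Defs where

open import Data.Nat using (ℕ; zero; suc; _+_; _<_)
open import Data.Fin using (Fin) renaming (_<_ to _<ᶠ_)
open import Data.Fin.Properties using () renaming (_≟_ to _≟ᶠ_)
open import Data.Bool using (Bool; true; false; T)
open import Data.List using (List; []; _∷_; _++_; length; lookup; drop; take; concat; map; upTo; filterᵇ)
open import Data.List.Membership.Propositional using (_∈_)
open import Data.List.Relation.Unary.All using (All)
open import Data.List.Relation.Unary.Unique.Propositional using (Unique)
open import Data.Product using (Σ; ∃; ∃-syntax; _×_; _,_)
open import Data.Sum using (_⊎_)
open import Relation.Binary.PropositionalEquality using (_≡_; _≢_)
open import Relation.Nullary using (¬_; does)
open import Function.Bundles using (_⇔_)

record Graph (n : ℕ) : Set₁ where
  field
    Adj     : Fin n → Fin n → Set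
    symm    : ∀ {u v} → Adj u v → Adj v u
    irrefl  : ∀ {u} → ¬ Adj u u
open Graph public

data Walk {n} (G : Graph n) : List (Fin n) → Set where
  single : ∀ v → Walk G (v ∷ [])
  step   : ∀ {u v vs} → Adj G u v → Walk G (v ∷ vs) → Walk G (u ∷ v ∷ vs)

IsPath : ∀ {n} (G : Graph n) (x y : Fin n) (int : List (Fin n)) → Set
IsPath G x y int = Walk G (x ∷ int ++ y ∷ []) × Unique (x ∷ int ++ y ∷ [])

Connected : ∀ {n} → Graph n → Set
Connected {n} G = ∀ (u v : Fin n) → u ≢ v → ∃[ int ] IsPath G u v int

-- Circle representations, given by their circular word τ
-- (a linear representative of the circular word).

count : ∀ {n} → Fin n → List (Fin n) → ℕ
count v []      = 0
count v (w ∷ τ) with does (v ≟ᶠ w)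
... | true  = suc (count v τ)
... | false = count v τ

AltPattern : ∀ {n} → List (Fin n) → Fin n → Fin n → Set
AltPattern τ u v =
  Σ (Fin (length τ)) λ i → Σ (Fin (length τ)) λ j →
  Σ (Fin (length τ)) λ k → Σ (Fin (length τ)) λ l →
    i <ᶠ j × j <ᶠ k × k <ᶠ l ×
    lookup τ i ≡ u × lookup τ j ≡ v × lookup τ k ≡ u × lookup τ l ≡ v

Alternate : ∀ {n} → List (Fin n) → Fin n → Fin n → Set
Alternate τ u v = AltPattern τ u v ⊎ AltPattern τ v u

record CircleRep {n} (G : Graph n) : Set where
  field
    word      : List (Fin n)
    twice     : ∀ v → count v word ≡ 2
    adj⇔alt   : ∀ u v → u ≢ v → (Adj G u v ⇔ Alternate word u v)
open CircleRep public

IsCircleGraph : ∀ {n} → Graph n → Set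
IsCircleGraph G = CircleRep G

data Part : Set where
  pA pB psA psB : Part

record Split {n} (G : Graph n) : Set where
  field
    part   : Fin n → Part
    A-B    : ∀ a b → part a ≡ pA → part b ≡ pB → Adj G a b
    sA-Bs  : ∀ u v → part u ≡ psA → (part v ≡ pB ⊎ part v ≡ psB) → ¬ Adj G u v
    sB-As  : ∀ u v → part u ≡ psB → (part v ≡ pA ⊎ part v ≡ psA) → ¬ Adj G u v
    sizeA  : ∃[ u ] ∃[ v ] (u ≢ v × (part u ≡ pA ⊎ part u ≡ psA) × (part v ≡ pA ⊎ part v ≡ psA))
    sizeB  : ∃[ u ] ∃[ v ] (u ≢ v × (part u ≡ pB ⊎ part u ≡ psB) × (part v ≡ pB ⊎ part v ≡ psB))
open Split public

isAB : Part → Bool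
isAB pA  = true
isAB pB  = true
isAB psA = false
isAB psB = false

gamma : ∀ {n} {G : Graph n} → Split G → List (Fin n) → List (Fin n)
gamma S τ = filterᵇ (λ v → isAB (part S v)) τ

rotate : ∀ {X : Set} → ℕ → List X → List X
rotate j xs = drop j xs ++ take j xs

-- A decomposition γ = γ₁ ⋯ γ_{2k} (circularly) into maximal A-/B-words,
-- indexed by ℕ with period 2k.
record Decomposition {n} {G : Graph n} (S : Split G) (γ : List (Fin n)) (k : ℕ) : Set where
  field
    block     : ℕ → List (Fin n)
    periodic  : ∀ i → block (i + (k + k)) ≡ block i
    nonempty  : ∀ i → block i ≢ []
    alternate : ∀ i →
      (All (λ v → part S v ≡ pA) (block i) × All (λ v → part S v ≡ pB) (block (suc i)))
      ⊎ (All (λ v → part S v ≡ pB) (block i) × All (λ v → part S v ≡ pA) (block (suc i)))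
    covers    : ∃[ j ] rotate j γ ≡ concat (map block (upTo (k + k)))
open Decomposition public

-- Rotate the word of the representation so that γ reads γ₁ ⋯ γ_{2k} from its start, and let lo v ≤ hi v be the
-- indices of the blocks holding the two endpoints of a chord v of A ∪ B. As A is complete to B, chords meeting
-- consecutive blocks cross. For a chord at block t, the length of the arc from t forward to its other endpoint
-- therefore cannot decrease from one block to the next; once round the circle it is constant, so every chord of
-- A ∪ B joins γ_t to γ_{t+k}. If lo x < lo y, the first letters c of γ_{lo x + 1} and d of γ_{lo y + 1} give two
-- crossing B-chords whose four quadrants separate the endpoints of x from those of y. A chord of s(A) crosses no
-- B-chord, so it lies in a single quadrant, which every chord crossing it meets; along the path through s(A) this
-- yields a quadrant met by both x and y. Hence lo x = lo y, and hi x = hi y = lo x + k.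

module Submission where

open import Defs
open import Data.Bool using (Bool; true; false)
open import Data.Empty using (⊥; ⊥-elim)
open import Data.Fin using (Fin; toℕ) renaming (zero to fzero; suc to fsuc)
open import Data.Fin.Properties using () renaming (_≟_ to _≟ᶠ_)
open import Data.List using (List; []; _∷_; _++_; length; lookup; drop; take; concat; map; upTo; applyUpTo; filterᵇ)
open import Data.List.Properties
  using (++-assoc; ++-identityʳ; take++drop≡id; take-all; drop-all; filter-++; length-++-≤ˡ; map-applyUpTo)
open import Data.List.Membership.Propositional using (_∈_)
open import Data.List.Relation.Unary.Any using (here; there)
open import Data.List.Relation.Unary.All using (All; []; _∷_) renaming (lookup to All-lookup)
open import Data.Nat using (ℕ; zero; suc; _+_; _∸_; _≤_; _<_; z≤n; s≤s; z<s; s≤s⁻¹; _≤?_; _<?_; ⌊_/2⌋)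
open import Data.Nat.Properties
open import Data.Product using (Σ; ∃-syntax; _×_; _,_; proj₁; proj₂)
import Data.Product as Product
open import Data.Sum using (_⊎_; inj₁; inj₂)
import Data.Sum as Sum
open import Function.Base using (id; _∘_; _∘′_; case_of_)
open import Function.Bundles using (_⇔_; mk⇔; Equivalence)
open import Function.Construct.Composition using (_⇔-∘_)
open import Relation.Binary.Definitions using (tri<; tri≈; tri>)
open import Relation.Binary.PropositionalEquality
  using (_≡_; _≢_; refl; sym; trans; cong; cong₂; subst; subst₂; module ≡-Reasoning)
open import Relation.Nullary using (¬_; yes; no; does)
open import Relation.Nullary.Decidable.Core using (T?)

infix 4 _[_]=_

data _[_]=_ {X : Set} : List X → ℕ → X → Set where
  here  : ∀ {x xs} → (x ∷ xs) [ 0 ]= x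
  there : ∀ {y xs p x} → xs [ p ]= x → (y ∷ xs) [ suc p ]= x

module _ {X : Set} where

  []=-functional : ∀ {xs : List X} {p x y} → xs [ p ]= x → xs [ p ]= y → x ≡ y
  []=-functional here      here      = refl
  []=-functional (there a) (there b) = []=-functional a b

  []=⇒<length : ∀ {xs : List X} {p x} → xs [ p ]= x → p < length xs
  []=⇒<length here      = s≤s z≤n
  []=⇒<length (there a) = s≤s ([]=⇒<length a)

  lookup⇒[]= : ∀ (xs : List X) i → xs [ toℕ i ]= lookup xs i
  lookup⇒[]= (x ∷ xs) fzero    = here
  lookup⇒[]= (x ∷ xs) (fsuc i) = there (lookup⇒[]= xs i)

  []=⇒lookup : ∀ {xs : List X} {p x} → xs [ p ]= x →
    Σ (Fin (length xs)) λ i → toℕ i ≡ p × lookup xs i ≡ x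
  []=⇒lookup here = fzero , refl , refl
  []=⇒lookup (there a) with []=⇒lookup a
  ... | i , refl , eq = fsuc i , refl , eq

  []=⇒∈ : ∀ {xs : List X} {p x} → xs [ p ]= x → x ∈ xs
  []=⇒∈ here      = here refl
  []=⇒∈ (there a) = there ([]=⇒∈ a)

  ∈⇒[]= : ∀ {xs : List X} {x} → x ∈ xs → ∃[ p ] xs [ p ]= x
  ∈⇒[]= (here refl) = 0 , here
  ∈⇒[]= (there x∈) with ∈⇒[]= x∈
  ... | p , a = suc p , there a

  []=-++⁺ˡ : ∀ {xs ys : List X} {p x} → xs [ p ]= x → xs ++ ys [ p ]= x
  []=-++⁺ˡ here      = here
  []=-++⁺ˡ (there a) = there ([]=-++⁺ˡ a)

  []=-++⁺ʳ : ∀ (xs : List X) {ys p x} → ys [ p ]= x → xs ++ ys [ length xs + p ]= x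
  []=-++⁺ʳ []       a = a
  []=-++⁺ʳ (_ ∷ xs) a = there ([]=-++⁺ʳ xs a)

  []=-++⁻ : ∀ (xs : List X) {ys p x} → xs ++ ys [ p ]= x →
    (p < length xs × xs [ p ]= x) ⊎ ∃[ q ] (p ≡ length xs + q × ys [ q ]= x)
  []=-++⁻ []       a         = inj₂ (_ , refl , a)
  []=-++⁻ (_ ∷ xs) here      = inj₁ (s≤s z≤n , here)
  []=-++⁻ (_ ∷ xs) (there a) with []=-++⁻ xs a
  ... | inj₁ (p< , b)      = inj₁ (s≤s p< , there b)
  ... | inj₂ (q , refl , b) = inj₂ (q , refl , b)

  []=-++⁻ˡ : ∀ (xs : List X) {ys p x} → xs ++ ys [ p ]= x → p < length xs → xs [ p ]= x
  []=-++⁻ˡ xs a p< with []=-++⁻ xs a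
  ... | inj₁ (_ , b)        = b
  ... | inj₂ (q , refl , _) = ⊥-elim (m+n≮m (length xs) q p<)

-- Alternation and rotation

record AltAt {X : Set} (τ : List X) (u v : X) : Set where
  constructor altAt
  field
    i j k l : ℕ
    i<j : i < j
    j<k : j < k
    k<l : k < l
    atᵢ : τ [ i ]= u
    atⱼ : τ [ j ]= v
    atₖ : τ [ k ]= u
    atₗ : τ [ l ]= v

Alt : ∀ {X : Set} → List X → X → X → Set
Alt τ u v = AltAt τ u v ⊎ AltAt τ v u

Alt-sym : ∀ {X : Set} {τ : List X} {u v} → Alt τ u v → Alt τ v u
Alt-sym = Sum.swap

module _ {n} {τ : List (Fin n)} where

  AltPattern⇒AltAt : ∀ {u v} → AltPattern τ u v → AltAt τ u v
  AltPattern⇒AltAt (i , j , k , l , i<j , j<k , k<l , eᵢ , eⱼ , eₖ , eₗ) =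
    altAt _ _ _ _ i<j j<k k<l (at i eᵢ) (at j eⱼ) (at k eₖ) (at l eₗ)
    where
    at : ∀ p {x} → lookup τ p ≡ x → τ [ toℕ p ]= x
    at p refl = lookup⇒[]= τ p

  AltAt⇒AltPattern : ∀ {u v} → AltAt τ u v → AltPattern τ u v
  AltAt⇒AltPattern (altAt _ _ _ _ i<j j<k k<l aᵢ aⱼ aₖ aₗ)
    with []=⇒lookup aᵢ | []=⇒lookup aⱼ | []=⇒lookup aₖ | []=⇒lookup aₗ
  ... | i , refl , eᵢ | j , refl , eⱼ | k , refl , eₖ | l , refl , eₗ =
    i , j , k , l , i<j , j<k , k<l , eᵢ , eⱼ , eₖ , eₗ

  Alternate⇔Alt : ∀ {u v} → Alternate τ u v ⇔ Alt τ u v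
  Alternate⇔Alt = mk⇔ (Sum.map AltPattern⇒AltAt AltPattern⇒AltAt)
                      (Sum.map AltAt⇒AltPattern AltAt⇒AltPattern)

-- Moving the first letter to the end turns u v u v into v u v u when it moves a u.
AltAt-rotate₁ : ∀ {X : Set} {a : X} {σ u v} → AltAt (a ∷ σ) u v → Alt (σ ++ a ∷ []) u v
AltAt-rotate₁ {σ = σ} (altAt zero (suc j) (suc k) (suc l) _ (s≤s j<k) (s≤s k<l) here (there aⱼ) (there aₖ) (there aₗ)) =
  inj₂ (altAt j k l (length σ) j<k k<l ([]=⇒<length aₗ) ([]=-++⁺ˡ aⱼ) ([]=-++⁺ˡ aₖ) ([]=-++⁺ˡ aₗ)
    (subst (λ p → σ ++ _ ∷ [] [ p ]= _) (+-identityʳ (length σ)) ([]=-++⁺ʳ σ here)))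
AltAt-rotate₁ (altAt (suc i) (suc j) (suc k) (suc l) (s≤s i<j) (s≤s j<k) (s≤s k<l)
                     (there aᵢ) (there aⱼ) (there aₖ) (there aₗ)) =
  inj₁ (altAt i j k l i<j j<k k<l ([]=-++⁺ˡ aᵢ) ([]=-++⁺ˡ aⱼ) ([]=-++⁺ˡ aₖ) ([]=-++⁺ˡ aₗ))

AltAt-unrotate₁ : ∀ {X : Set} (a : X) σ {u v} → AltAt (σ ++ a ∷ []) u v → Alt (a ∷ σ) u v
AltAt-unrotate₁ a σ (altAt i j k l i<j j<k k<l aᵢ aⱼ aₖ aₗ) with []=-++⁻ σ aₗ
... | inj₁ (l< , aₗ') =
  let k< = <-trans k<l l< ; j< = <-trans j<k k< ; i< = <-trans i<j j< in
  inj₁ (altAt (suc i) (suc j) (suc k) (suc l) (s≤s i<j) (s≤s j<k) (s≤s k<l)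
    (there ([]=-++⁻ˡ σ aᵢ i<)) (there ([]=-++⁻ˡ σ aⱼ j<)) (there ([]=-++⁻ˡ σ aₖ k<)) (there aₗ'))
... | inj₂ (zero , refl , here) =
  let k< = subst (k <_) (+-identityʳ (length σ)) k<l ; j< = <-trans j<k k< ; i< = <-trans i<j j< in
  inj₂ (altAt 0 (suc i) (suc j) (suc k) (s≤s z≤n) (s≤s i<j) (s≤s j<k) here
    (there ([]=-++⁻ˡ σ aᵢ i<)) (there ([]=-++⁻ˡ σ aⱼ j<)) (there ([]=-++⁻ˡ σ aₖ k<)))
... | inj₂ (suc q , refl , there ())

Alt-rotate₁ : ∀ {X : Set} (a : X) σ {u v} → Alt (a ∷ σ) u v ⇔ Alt (σ ++ a ∷ []) u v
Alt-rotate₁ a σ = mk⇔ (Sum.[ AltAt-rotate₁ , Alt-sym ∘′ AltAt-rotate₁ ])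
                      (Sum.[ AltAt-unrotate₁ a σ , Alt-sym ∘′ AltAt-unrotate₁ a σ ])

module _ {X : Set} where

  drop-++-≤ : ∀ m (σ ys : List X) → m ≤ length σ → drop m (σ ++ ys) ≡ drop m σ ++ ys
  drop-++-≤ zero    σ       ys _         = refl
  drop-++-≤ (suc m) (x ∷ σ) ys (s≤s m≤) = drop-++-≤ m σ ys m≤

  take-++-≤ : ∀ m (σ ys : List X) → m ≤ length σ → take m (σ ++ ys) ≡ take m σ
  take-++-≤ zero    σ       ys _         = refl
  take-++-≤ (suc m) (x ∷ σ) ys (s≤s m≤) = cong (x ∷_) (take-++-≤ m σ ys m≤)

  rotate-suc : ∀ m (a : X) σ → m ≤ length σ → rotate (suc m) (a ∷ σ) ≡ rotate m (σ ++ a ∷ [])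
  rotate-suc m a σ m≤ = begin
    drop m σ ++ a ∷ take m σ                            ≡⟨ ++-assoc (drop m σ) (a ∷ []) (take m σ) ⟨
    (drop m σ ++ a ∷ []) ++ take m σ                    ≡⟨ cong₂ _++_ (drop-++-≤ m σ _ m≤) (take-++-≤ m σ _ m≤) ⟨
    drop m (σ ++ a ∷ []) ++ take m (σ ++ a ∷ [])        ∎
    where open ≡-Reasoning

  rotate-++ : ∀ (xs ys : List X) → rotate (length xs) (xs ++ ys) ≡ ys ++ xs
  rotate-++ xs ys = cong₂ _++_ (drop-length-++ xs) (take-length-++ xs)
    where
    drop-length-++ : ∀ xs → drop (length xs) (xs ++ ys) ≡ ys
    drop-length-++ []       = refl
    drop-length-++ (_ ∷ xs) = drop-length-++ xs
    take-length-++ : ∀ xs → take (length xs) (xs ++ ys) ≡ xs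
    take-length-++ []       = refl
    take-length-++ (x ∷ xs) = cong (x ∷_) (take-length-++ xs)

  rotate-≥ : ∀ j (xs : List X) → length xs ≤ j → rotate j xs ≡ xs
  rotate-≥ j xs ≥ = cong₂ _++_ (drop-all j xs ≥) (take-all j xs ≥)

Alt-rotate : ∀ {X : Set} m (τ : List X) {u v} → m ≤ length τ → Alt τ u v ⇔ Alt (rotate m τ) u v
Alt-rotate zero    τ       _ rewrite ++-identityʳ τ = mk⇔ id id
Alt-rotate (suc m) (a ∷ σ) (s≤s m≤) rewrite rotate-suc m a σ m≤ =
  Alt-rotate m (σ ++ a ∷ []) (≤-trans m≤ (length-++-≤ˡ σ)) ⇔-∘ Alt-rotate₁ a σ

count-++ : ∀ {n} (v : Fin n) xs ys → count v (xs ++ ys) ≡ count v xs + count v ys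
count-++ v []       ys = refl
count-++ v (w ∷ xs) ys with does (v ≟ᶠ w)
... | true  = cong suc (count-++ v xs ys)
... | false = count-++ v xs ys

count-rotate : ∀ {n} (v : Fin n) m τ → count v (rotate m τ) ≡ count v τ
count-rotate v m τ = begin
  count v (drop m τ ++ take m τ)          ≡⟨ count-++ v (drop m τ) (take m τ) ⟩
  count v (drop m τ) + count v (take m τ) ≡⟨ +-comm (count v (drop m τ)) _ ⟩
  count v (take m τ) + count v (drop m τ) ≡⟨ count-++ v (take m τ) (drop m τ) ⟨
  count v (take m τ ++ drop m τ)          ≡⟨ cong (count v) (take++drop≡id m τ) ⟩
  count v τ                               ∎
  where open ≡-Reasoning

module _ {X : Set} (p : X → Bool) where

  filterᵇ-accept : ∀ {x} xs → p x ≡ true → filterᵇ p (x ∷ xs) ≡ x ∷ filterᵇ p xs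
  filterᵇ-accept {x} xs px with p x
  ... | true = refl

  filterᵇ-reject : ∀ {x} xs → p x ≡ false → filterᵇ p (x ∷ xs) ≡ filterᵇ p xs
  filterᵇ-reject {x} xs px with p x
  ... | false = refl

  -- The length of the filtered prefix grows by steps of at most one.
  filterᵇ-prefix-of-length : ∀ τ j → j ≤ length (filterᵇ p τ) →
    ∃[ m ] (m ≤ length τ × length (filterᵇ p (take m τ)) ≡ j)
  filterᵇ-prefix-of-length τ       zero    _ = 0 , z≤n , refl
  filterᵇ-prefix-of-length (x ∷ τ) (suc j) j≤ with p x in px
  ... | true with filterᵇ-prefix-of-length τ j (s≤s⁻¹ j≤)
  ...   | m , m≤ , e = suc m , s≤s m≤ , trans (cong length (filterᵇ-accept (take m τ) px)) (cong suc e)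
  filterᵇ-prefix-of-length (x ∷ τ) (suc j) j≤ | false with filterᵇ-prefix-of-length τ (suc j) j≤
  ...   | m , m≤ , e = suc m , s≤s m≤ , trans (cong length (filterᵇ-reject (take m τ) px)) e

  filterᵇ-rotate : ∀ τ m → filterᵇ p (rotate m τ) ≡ rotate (length (filterᵇ p (take m τ))) (filterᵇ p τ)
  filterᵇ-rotate τ m = begin
    filterᵇ p (drop m τ ++ take m τ)           ≡⟨ filter-++ (T? ∘ p) (drop m τ) (take m τ) ⟩
    suffix ++ prefix                           ≡⟨ rotate-++ prefix suffix ⟨
    rotate j (prefix ++ suffix)                ≡⟨ cong (rotate j) (filter-++ (T? ∘ p) (take m τ) (drop m τ)) ⟨
    rotate j (filterᵇ p (take m τ ++ drop m τ)) ≡⟨ cong (rotate j ∘ filterᵇ p) (take++drop≡id m τ) ⟩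
    rotate j (filterᵇ p τ)                     ∎
    where
    open ≡-Reasoning
    prefix = filterᵇ p (take m τ)
    suffix = filterᵇ p (drop m τ)
    j = length prefix

  rotate-filterᵇ-lift : ∀ τ j → ∃[ m ] (m ≤ length τ × filterᵇ p (rotate m τ) ≡ rotate j (filterᵇ p τ))
  rotate-filterᵇ-lift τ j with j ≤? length (filterᵇ p τ)
  ... | yes j≤ with filterᵇ-prefix-of-length τ j j≤
  ...   | m , m≤ , refl = m , m≤ , filterᵇ-rotate τ m
  rotate-filterᵇ-lift τ j | no j≰ =
    0 , z≤n , trans (cong (filterᵇ p) (++-identityʳ τ)) (sym (rotate-≥ j _ (<⇒≤ (≰⇒> j≰))))

-- Chords

Interleaved : ℕ → ℕ → ℕ → ℕ → Set
Interleaved a b c d = (a < c × c < b × b < d) ⊎ (c < a × a < d × d < b)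

Interleaved-sym : ∀ {a b c d} → Interleaved a b c d → Interleaved c d a b
Interleaved-sym = Sum.swap

Interleaved⇒< : ∀ {a b c d} → Interleaved a b c d → a < b
Interleaved⇒< (inj₁ (a<c , c<b , _)) = <-trans a<c c<b
Interleaved⇒< (inj₂ (_ , a<d , d<b)) = <-trans a<d d<b

record Occurrences {n} (τ : List (Fin n)) (v : Fin n) : Set where
  constructor occurrences
  field
    first second : ℕ
    first<second : first < second
    at-first     : τ [ first ]= v
    at-second    : τ [ second ]= v
    only         : ∀ {p} → τ [ p ]= v → p ≡ first ⊎ p ≡ second

module _ {n} {v : Fin n} where

  count≡0⇒∉ : ∀ τ {p} → count v τ ≡ 0 → τ [ p ]= v → ⊥
  count≡0⇒∉ (w ∷ τ) c≡0 a with v ≟ᶠ w | a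
  ... | yes _  | _       = case c≡0 of λ ()
  ... | no v≢w | here    = v≢w refl
  ... | no _   | there a = count≡0⇒∉ τ c≡0 a

  count≡1⇒unique : ∀ τ → count v τ ≡ 1 → ∃[ q ] (τ [ q ]= v × ∀ {p} → τ [ p ]= v → p ≡ q)
  count≡1⇒unique (w ∷ τ) c≡1 with v ≟ᶠ w
  ... | yes refl = 0 , here , λ { here → refl ; (there a) → ⊥-elim (count≡0⇒∉ τ (suc-injective c≡1) a) }
  ... | no v≢w with count≡1⇒unique τ c≡1
  ...   | q , a , unique = suc q , there a , λ { here → ⊥-elim (v≢w refl) ; (there b) → cong suc (unique b) }

  count≡2⇒occurrences : ∀ τ → count v τ ≡ 2 → Occurrences τ v
  count≡2⇒occurrences (w ∷ τ) c≡2 with v ≟ᶠ w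
  ... | yes refl with count≡1⇒unique τ (suc-injective c≡2)
  ...   | q , a , unique = occurrences 0 (suc q) (s≤s z≤n) here (there a)
          λ { here → inj₁ refl ; (there b) → inj₂ (cong suc (unique b)) }
  count≡2⇒occurrences (w ∷ τ) c≡2 | no v≢w with count≡2⇒occurrences τ c≡2
  ... | occurrences a b a<b at-a at-b only = occurrences (suc a) (suc b) (s≤s a<b) (there at-a) (there at-b)
          λ { here → ⊥-elim (v≢w refl) ; (there c) → Sum.map (cong suc) (cong suc) (only c) }

module _ {n} {τ : List (Fin n)} where
  open Occurrences

  occurrences-ordered : ∀ {u} (P : Occurrences τ u) {i k} → τ [ i ]= u → τ [ k ]= u → i < k →
    i ≡ first P × k ≡ second P
  occurrences-ordered P aᵢ aₖ i<k with only P aᵢ | only P aₖ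
  ... | inj₁ refl | inj₁ refl = ⊥-elim (<-irrefl refl i<k)
  ... | inj₁ eᵢ   | inj₂ eₖ   = eᵢ , eₖ
  ... | inj₂ refl | inj₁ refl = ⊥-elim (<-asym i<k (first<second P))
  ... | inj₂ refl | inj₂ refl = ⊥-elim (<-irrefl refl i<k)

  AltAt⇒ordered : ∀ {u v} (P : Occurrences τ u) (Q : Occurrences τ v) → AltAt τ u v →
    first P < first Q × first Q < second P × second P < second Q
  AltAt⇒ordered P Q (altAt _ _ _ _ i<j j<k k<l aᵢ aⱼ aₖ aₗ)
    with occurrences-ordered P aᵢ aₖ (<-trans i<j j<k) | occurrences-ordered Q aⱼ aₗ (<-trans j<k k<l)
  ... | refl , refl | refl , refl = i<j , j<k , k<l

  Alt⇔Interleaved : ∀ {u v} (P : Occurrences τ u) (Q : Occurrences τ v) →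
    Alt τ u v ⇔ Interleaved (first P) (second P) (first Q) (second Q)
  Alt⇔Interleaved P Q = mk⇔
    Sum.[ inj₁ ∘ AltAt⇒ordered P Q , inj₂ ∘ AltAt⇒ordered Q P ]
    Sum.[ (λ (a , b , c) → inj₁ (altAt _ _ _ _ a b c (at-first P) (at-first Q) (at-second P) (at-second Q)))
        , (λ (a , b , c) → inj₂ (altAt _ _ _ _ a b c (at-first Q) (at-first P) (at-second Q) (at-second P))) ]

-- Blocks

module _ {X : Set} where

  blockIndex : (ℕ → List X) → ℕ → ℕ → ℕ
  blockIndex f zero    g = 0
  blockIndex f (suc K) g with g <? length (f 0)
  ... | yes _ = 0
  ... | no  _ = suc (blockIndex (f ∘ suc) K (g ∸ length (f 0)))

  blockIndex-∈ : ∀ f K {g v} → concat (applyUpTo f K) [ g ]= v → blockIndex f K g < K × v ∈ f (blockIndex f K g)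
  blockIndex-∈ f (suc K) {g} a with g <? length (f 0) | []=-++⁻ (f 0) a
  ... | yes _   | inj₁ (_ , a₀)        = s≤s z≤n , []=⇒∈ a₀
  ... | yes g<  | inj₂ (q , refl , _)  = ⊥-elim (m+n≮m (length (f 0)) q g<)
  ... | no  g≮  | inj₁ (g< , _)        = ⊥-elim (g≮ g<)
  ... | no  _   | inj₂ (q , refl , a′) rewrite m+n∸m≡n (length (f 0)) q =
    Product.map s≤s id (blockIndex-∈ (f ∘ suc) K a′)

  blockIndex-mono : ∀ f K {g g′} → g ≤ g′ → blockIndex f K g ≤ blockIndex f K g′
  blockIndex-mono f zero    g≤ = z≤n
  blockIndex-mono f (suc K) {g} {g′} g≤ with g <? length (f 0) | g′ <? length (f 0)
  ... | yes _  | _       = z≤n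
  ... | no g≮  | yes g′< = ⊥-elim (g≮ (≤-<-trans g≤ g′<))
  ... | no _   | no _    = s≤s (blockIndex-mono (f ∘ suc) K (∸-monoˡ-≤ (length (f 0)) g≤))

  blockIndex-head : ∀ f K {g} → g < length (f 0) → blockIndex f (suc K) g ≡ 0
  blockIndex-head f K {g} g< with g <? length (f 0)
  ... | yes _ = refl
  ... | no g≮ = ⊥-elim (g≮ g<)

  blockIndex-tail : ∀ f K g → blockIndex f (suc K) (length (f 0) + g) ≡ suc (blockIndex (f ∘ suc) K g)
  blockIndex-tail f K g with length (f 0) + g <? length (f 0)
  ... | yes g< = ⊥-elim (m+n≮m (length (f 0)) g g<)
  ... | no _   = cong (suc ∘ blockIndex (f ∘ suc) K) (m+n∸m≡n (length (f 0)) g)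

  blockIndex-surjective : ∀ f K {t v} → v ∈ f t → t < K →
    ∃[ g ] (concat (applyUpTo f K) [ g ]= v × blockIndex f K g ≡ t)
  blockIndex-surjective f (suc K) {zero} v∈ _ with ∈⇒[]= v∈
  ... | g , a = g , []=-++⁺ˡ a , blockIndex-head f K ([]=⇒<length a)
  blockIndex-surjective f (suc K) {suc t} v∈ (s≤s t<) with blockIndex-surjective (f ∘ suc) K v∈ t<
  ... | g , a , refl = length (f 0) + g , []=-++⁺ʳ (f 0) a , blockIndex-tail f K g

  filteredIndex : (X → Bool) → List X → ℕ → ℕ
  filteredIndex p τ q = length (filterᵇ p (take q τ))

  filteredIndex-[]= : ∀ p τ {q v} → τ [ q ]= v → p v ≡ true → filterᵇ p τ [ filteredIndex p τ q ]= v
  filteredIndex-[]= p (x ∷ τ) here        px rewrite filterᵇ-accept p τ px = here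
  filteredIndex-[]= p (x ∷ τ) (there a) pv with p x
  ... | true  = there (filteredIndex-[]= p τ a pv)
  ... | false = filteredIndex-[]= p τ a pv

  filterᵇ-≢[] : ∀ p τ {q x} → τ [ q ]= x → p x ≡ true → filterᵇ p τ ≢ []
  filterᵇ-≢[] p τ {q} a px ≡[] = case subst (_[ filteredIndex p τ q ]= _) ≡[] (filteredIndex-[]= p τ a px) of λ ()

  filteredIndex-mono : ∀ p τ {q q′} → q ≤ q′ → filteredIndex p τ q ≤ filteredIndex p τ q′
  filteredIndex-mono p τ       {zero}           _         = z≤n
  filteredIndex-mono p []      {suc q} {suc q′} _         = z≤n
  filteredIndex-mono p (x ∷ τ) {suc q} {suc q′} (s≤s q≤) with p x
  ... | true  = s≤s (filteredIndex-mono p τ q≤)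
  ... | false = filteredIndex-mono p τ q≤

  filteredIndex-surjective : ∀ p τ {g v} → filterᵇ p τ [ g ]= v → ∃[ q ] (τ [ q ]= v × filteredIndex p τ q ≡ g)
  filteredIndex-surjective p (x ∷ τ) a with p x in px
  filteredIndex-surjective p (x ∷ τ) here      | true = 0 , here , refl
  filteredIndex-surjective p (x ∷ τ) (there a) | true with filteredIndex-surjective p τ a
  ... | q , b , refl = suc q , there b , cong length (filterᵇ-accept p (take q τ) px)
  filteredIndex-surjective p (x ∷ τ) a | false with filteredIndex-surjective p τ a
  ... | q , b , refl = suc q , there b , cong length (filterᵇ-reject p (take q τ) px)

-- Diameters

<⇒∸≤∸suc : ∀ {a b} c → a < b → a ∸ c ≤ b ∸ suc c
<⇒∸≤∸suc {b = suc b} c (s≤s a≤b) = ∸-monoˡ-≤ c a≤b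

Touches : ∀ {V : Set} (lo hi : V → ℕ) → V → ℕ → Set
Touches lo hi v t = lo v ≡ t ⊎ hi v ≡ t

-- Points 0 … K′ of a circle of circumference K = suc K′ = k + k, and chords v with endpoints lo v ≤ hi v;
-- witness t is a chord at t, and chords at consecutive points cross.
module Diameters {V : Set} (Chord : V → Set) (lo hi : V → ℕ) (k K′ : ℕ) (K≡k+k : suc K′ ≡ k + k)
  (lo≤hi : ∀ {v} → Chord v → lo v ≤ hi v)
  (hi<K : ∀ {v} → Chord v → hi v < suc K′)
  (witness : ℕ → V)
  (witness-chord : ∀ t → t < suc K′ → Chord (witness t))
  (witness-touches : ∀ t → t < suc K′ → Touches lo hi (witness t) t)
  (crossing-next : ∀ {u v t} → Chord u → Chord v → suc t < suc K′ →
     Touches lo hi u t → Touches lo hi v (suc t) → Interleaved (lo u) (hi u) (lo v) (hi v))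
  (crossing-wrap : ∀ {u v} → Chord u → Chord v →
     Touches lo hi u K′ → Touches lo hi v 0 → Interleaved (lo u) (hi u) (lo v) (hi v))
  where

  K : ℕ
  K = suc K′

  -- the length of the arc running forward from the endpoint t of v to its other endpoint
  arc : V → ℕ → ℕ
  arc v t with lo v ≟ t
  ... | yes _ = hi v ∸ lo v
  ... | no  _ = K ∸ (hi v ∸ lo v)

  arc-spec : ∀ {v t} → Touches lo hi v t →
    (lo v ≡ t × arc v t ≡ hi v ∸ lo v) ⊎ (lo v ≢ t × hi v ≡ t × arc v t ≡ K ∸ (hi v ∸ lo v))
  arc-spec {v} {t} touches with lo v ≟ t | touches
  ... | yes lo≡ | _        = inj₁ (lo≡ , refl)
  ... | no lo≢  | inj₁ lo≡ = ⊥-elim (lo≢ lo≡)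
  ... | no lo≢  | inj₂ hi≡ = inj₂ (lo≢ , hi≡ , refl)

  arc-next : ∀ {u v t} → Chord u → Chord v → suc t < K → Touches lo hi u t → Touches lo hi v (suc t) →
    arc u t ≤ arc v (suc t)
  arc-next {u} {v} cu cv t< tu tv with crossing-next cu cv t< tu tv | arc-spec tu | arc-spec tv
  ... | inj₁ (_ , _ , hu<hv) | inj₁ (refl , eu) | inj₁ (lv≡ , ev) =
    subst₂ _≤_ (sym eu) (sym ev) (subst (λ l → hi u ∸ lo u ≤ hi v ∸ l) (sym lv≡) (<⇒∸≤∸suc (lo u) hu<hv))
  ... | inj₂ (lv<lu , _ , _) | inj₁ (refl , _) | inj₁ (lv≡ , _) =
    ⊥-elim (<-asym lv<lu (subst (lo u <_) (sym lv≡) (n<1+n (lo u))))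
  ... | inj₁ (lu<lv , lv<hu , hu<hv) | inj₁ (refl , _) | inj₂ (_ , hv≡ , _) =
    ⊥-elim (<-irrefl (sym hv≡) (≤-<-trans lu<lv (<-trans lv<hu hu<hv)))
  ... | inj₂ (_ , lu<hv , _) | inj₁ (refl , eu) | inj₂ (_ , hv≡ , ev) =
    subst₂ _≤_ (sym eu) (sym ev) (subst (λ h → hi u ∸ lo u ≤ K ∸ (h ∸ lo v)) (sym hv≡)
      (≤-trans (∸-monoˡ-≤ (lo u) (s≤s⁻¹ (hi<K cu))) (∸-monoʳ-≤ K (m∸n≤m (suc (lo u)) (lo v)))))
  ... | inj₁ (_ , lv<hu , _) | inj₂ (_ , refl , _) | inj₁ (lv≡ , _) =
    ⊥-elim (<-asym lv<hu (subst (hi u <_) (sym lv≡) (n<1+n (hi u))))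
  ... | inj₂ (lv<lu , _ , _) | inj₂ (_ , refl , _) | inj₁ (lv≡ , _) =
    ⊥-elim (<-asym (<-≤-trans lv<lu (lo≤hi cu)) (subst (hi u <_) (sym lv≡) (n<1+n (hi u))))
  ... | inj₁ (lu<lv , _ , _) | inj₂ (_ , refl , eu) | inj₂ (_ , hv≡ , ev) =
    subst₂ _≤_ (sym eu) (sym ev) (∸-monoʳ-≤ K (subst (λ h → h ∸ lo v ≤ hi u ∸ lo u) (sym hv≡)
      (∸-monoʳ-≤ (suc (hi u)) lu<lv)))
  ... | inj₂ (_ , _ , hv<hu) | inj₂ (_ , refl , _) | inj₂ (_ , hv≡ , _) =
    ⊥-elim (<-asym hv<hu (subst (hi u <_) (sym hv≡) (n<1+n (hi u))))

  arc-wrap : ∀ {u v} → Chord u → Chord v → Touches lo hi u K′ → Touches lo hi v 0 → arc u K′ ≤ arc v 0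
  arc-wrap {u} {v} cu cv tu tv with crossing-wrap cu cv tu tv | arc-spec tu | arc-spec tv
  ... | cross | inj₁ (lu≡ , _) | _ =
    ⊥-elim (<-irrefl lu≡ (<-≤-trans (Interleaved⇒< cross) (s≤s⁻¹ (hi<K cu))))
  ... | _ | inj₂ _ | inj₂ (lv≢0 , hv≡0 , _) = ⊥-elim (lv≢0 (n≤0⇒n≡0 (subst (lo v ≤_) hv≡0 (lo≤hi cv))))
  ... | inj₁ (lu<lv , _ , _) | inj₂ _ | inj₁ (lv≡0 , _) = ⊥-elim (n≮0 (subst (lo u <_) lv≡0 lu<lv))
  ... | inj₂ (_ , lu<hv , _) | inj₂ (_ , hu≡ , eu) | inj₁ (lv≡0 , ev) =
    subst₂ _≤_ (sym eu) (sym ev) (subst₂ (λ h l → K ∸ (h ∸ lo u) ≤ hi v ∸ l) (sym hu≡) (sym lv≡0)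
      (subst (_≤ hi v) (sym (suc-∸-∸ (subst (lo u ≤_) hu≡ (lo≤hi cu)))) lu<hv))
    where
    suc-∸-∸ : ∀ {l m} → l ≤ m → suc m ∸ (m ∸ l) ≡ suc l
    suc-∸-∸ {l} {m} l≤m = trans (+-∸-assoc 1 (m∸n≤m m l)) (cong suc (m∸[m∸n]≡n l≤m))

  Λ : ℕ
  Λ = arc (witness 0) 0

  witness-next : ∀ {t} → suc t < K → arc (witness t) t ≤ arc (witness (suc t)) (suc t)
  witness-next {t} t< = arc-next (witness-chord t t<′) (witness-chord (suc t) t<) t<
    (witness-touches t t<′) (witness-touches (suc t) t<)
    where t<′ = <-trans (n<1+n t) t<

  witness-wrap : arc (witness K′) K′ ≤ Λ
  witness-wrap = arc-wrap (witness-chord K′ ≤-refl) (witness-chord 0 z<s)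
    (witness-touches K′ ≤-refl) (witness-touches 0 z<s)

  witness-arc-mono : ∀ {s} t → s ≤ t → t < K → arc (witness s) s ≤ arc (witness t) t
  witness-arc-mono zero    z≤n _  = ≤-refl
  witness-arc-mono (suc t) s≤ t< with m≤n⇒m<n∨m≡n s≤
  ... | inj₂ refl = ≤-refl
  ... | inj₁ s<   = ≤-trans (witness-arc-mono t (s≤s⁻¹ s<) (<-trans (n<1+n t) t<)) (witness-next t<)

  -- Going once round the circle, the non-decreasing arcs of the witnesses return to Λ.
  witness-arc : ∀ t → t < K → arc (witness t) t ≡ Λ
  witness-arc t t< = ≤-antisym
    (≤-trans (witness-arc-mono K′ (s≤s⁻¹ t<) ≤-refl) witness-wrap)
    (witness-arc-mono t z≤n t<)

  arc-≤-Λ : ∀ {v} t → Chord v → t < K → Touches lo hi v t → arc v t ≤ Λ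
  arc-≤-Λ t cv t< tv with suc t <? K
  ... | yes t+1< = ≤-trans (arc-next cv (witness-chord (suc t) t+1<) t+1< tv (witness-touches (suc t) t+1<))
                           (≤-reflexive (witness-arc (suc t) t+1<))
  ... | no t+1≮ with ≤-antisym (s≤s⁻¹ t<) (s≤s⁻¹ (≮⇒≥ t+1≮))
  ...   | refl = arc-wrap cv (witness-chord 0 z<s) tv (witness-touches 0 z<s)

  Λ-≤-arc : ∀ {v} t → Chord v → t < K → Touches lo hi v t → Λ ≤ arc v t
  Λ-≤-arc zero cv _ tv = subst (_≤ arc _ 0) (witness-arc K′ ≤-refl)
    (arc-wrap (witness-chord K′ ≤-refl) cv (witness-touches K′ ≤-refl) tv)
  Λ-≤-arc (suc t) cv t< tv = subst (_≤ arc _ (suc t)) (witness-arc t t<′)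
    (arc-next (witness-chord t t<′) cv t< (witness-touches t t<′) tv)
    where t<′ = <-trans (n<1+n t) t<

  arc-constant : ∀ {v t} → Chord v → t < K → Touches lo hi v t → arc v t ≡ Λ
  arc-constant {t = t} cv t< tv = ≤-antisym (arc-≤-Λ t cv t< tv) (Λ-≤-arc t cv t< tv)

  lo<hi : ∀ {v} → Chord v → lo v < hi v
  lo<hi {v} cv with suc (lo v) <? K
  ... | yes lo+1< = Interleaved⇒< (crossing-next cv (witness-chord _ lo+1<) lo+1< (inj₁ refl) (witness-touches _ lo+1<))
  ... | no lo+1≮ with ≤-antisym (≤-trans (lo≤hi cv) (s≤s⁻¹ (hi<K cv))) (s≤s⁻¹ (≮⇒≥ lo+1≮))
  ...   | lo≡K′ = Interleaved⇒< (crossing-wrap cv (witness-chord 0 z<s) (inj₁ lo≡K′) (witness-touches 0 z<s))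

  -- Both arcs of v equal Λ, so they are halves of the circle.
  diameter : ∀ {v} → Chord v → hi v ≡ lo v + k
  diameter {v} cv with arc-spec {v} (inj₁ refl) | arc-spec {v} (inj₂ refl)
  ... | inj₂ (lo≢lo , _) | _ = ⊥-elim (lo≢lo refl)
  ... | inj₁ _ | inj₁ (lo≡hi , _) = ⊥-elim (<-irrefl lo≡hi (lo<hi cv))
  ... | inj₁ (_ , e₁) | inj₂ (_ , _ , e₂) = begin
    hi v                 ≡⟨ m+[n∸m]≡n (lo≤hi cv) ⟨
    lo v + (hi v ∸ lo v) ≡⟨ cong (lo v +_) (halves D≡K∸D) ⟩
    lo v + k             ∎
    where
    open ≡-Reasoning
    D = hi v ∸ lo v
    D≡K∸D : D ≡ K ∸ D
    D≡K∸D = trans (sym e₁) (trans (arc-constant cv (≤-<-trans (lo≤hi cv) (hi<K cv)) (inj₁ refl))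
                   (sym (trans (sym e₂) (arc-constant cv (hi<K cv) (inj₂ refl)))))
    D≤K : D ≤ K
    D≤K = ≤-trans (m∸n≤m (hi v) (lo v)) (<⇒≤ (hi<K cv))
    halves : D ≡ K ∸ D → D ≡ k
    halves eq = begin
      D               ≡⟨ n≡⌊n+n/2⌋ D ⟩
      ⌊ D + D /2⌋     ≡⟨ cong (λ x → ⌊ D + x /2⌋) eq ⟩
      ⌊ D + (K ∸ D) /2⌋ ≡⟨ cong ⌊_/2⌋ (trans (m+[n∸m]≡n D≤K) K≡k+k) ⟩
      ⌊ k + k /2⌋     ≡⟨ n≡⌊n+n/2⌋ k ⟨
      k               ∎

-- Quadrants cut out by two crossing chords

inside : ℕ → ℕ → ℕ → Bool
inside e f q with e <? q | q <? f
... | yes _ | yes _ = true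
... | _     | _     = false

module _ {e f q : ℕ} where

  inside-true : e < q → q < f → inside e f q ≡ true
  inside-true e<q q<f with e <? q | q <? f
  ... | yes _  | yes _  = refl
  ... | yes _  | no q≮f = ⊥-elim (q≮f q<f)
  ... | no e≮q | _      = ⊥-elim (e≮q e<q)

  inside-false : q ≤ e ⊎ f ≤ q → inside e f q ≡ false
  inside-false q∉ with e <? q | q <? f | q∉
  ... | yes e<q | yes _   | inj₁ q≤e = ⊥-elim (<⇒≱ e<q q≤e)
  ... | yes _   | yes q<f | inj₂ f≤q = ⊥-elim (<⇒≱ q<f f≤q)
  ... | yes _   | no _    | _        = refl
  ... | no _    | yes _   | _        = refl
  ... | no _    | no _    | _        = refl

  inside-true⁻ : inside e f q ≡ true → e < q × q < f
  inside-true⁻ eq with e <? q | q <? f | eq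
  ... | yes e<q | yes q<f | _ = e<q , q<f

  inside-false⁻ : inside e f q ≡ false → q ≤ e ⊎ f ≤ q
  inside-false⁻ eq with e <? q | q <? f | eq
  ... | yes _   | no q≮f | _ = inj₂ (≮⇒≥ q≮f)
  ... | no e≮q  | yes _  | _ = inj₁ (≮⇒≥ e≮q)
  ... | no e≮q  | no _   | _ = inj₁ (≮⇒≥ e≮q)

Avoids : ℕ → ℕ → ℕ → Set
Avoids e f q = q ≢ e × q ≢ f

Encloses : ℕ → ℕ → ℕ → ℕ → Set
Encloses p₁ p₂ e f = p₁ < e × f < p₂

inside-uncrossed : ∀ {e f p₁ p₂} → p₁ < p₂ → ¬ Interleaved p₁ p₂ e f → Avoids e f p₁ → Avoids e f p₂ →
  inside e f p₁ ≡ inside e f p₂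
inside-uncrossed {e} {f} {p₁} {p₂} p₁<p₂ uncrossed (p₁≢e , _) (_ , p₂≢f)
  with inside e f p₁ in s₁ | inside e f p₂ in s₂
... | true  | true  = refl
... | false | false = refl
... | true  | false with inside-true⁻ s₁ | inside-false⁻ s₂
...   | e<p₁ , _ | inj₁ p₂≤e    = ⊥-elim (<⇒≱ (<-trans e<p₁ p₁<p₂) p₂≤e)
...   | e<p₁ , p₁<f | inj₂ f≤p₂ = ⊥-elim (uncrossed (inj₂ (e<p₁ , p₁<f , ≤∧≢⇒< f≤p₂ (p₂≢f ∘ sym))))
inside-uncrossed {e} {f} {p₁} {p₂} p₁<p₂ uncrossed (p₁≢e , _) (_ , p₂≢f) | false | true
  with inside-false⁻ s₁ | inside-true⁻ s₂
...   | inj₂ f≤p₁ | _ , p₂<f    = ⊥-elim (<⇒≱ (<-trans p₁<p₂ p₂<f) f≤p₁)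
...   | inj₁ p₁≤e | e<p₂ , p₂<f = ⊥-elim (uncrossed (inj₁ (≤∧≢⇒< p₁≤e p₁≢e , e<p₂ , p₂<f)))

inside-between : ∀ {e f p₁ p₂ w} → p₁ < w → w < p₂ → inside e f p₁ ≡ inside e f p₂ →
  Avoids e f p₁ → Avoids e f p₂ → inside e f w ≡ inside e f p₁ ⊎ Encloses p₁ p₂ e f
inside-between {e} {f} {p₁} {p₂} p₁<w w<p₂ same (p₁≢e , _) (_ , p₂≢f) with inside e f p₁ in s₁
... | true with inside-true⁻ s₁ | inside-true⁻ (sym same)
...   | e<p₁ , _ | _ , p₂<f = inj₁ (inside-true (<-trans e<p₁ p₁<w) (<-trans w<p₂ p₂<f))
inside-between {e} {f} {p₁} {p₂} p₁<w w<p₂ same (p₁≢e , _) (_ , p₂≢f) | false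
  with inside-false⁻ s₁ | inside-false⁻ (sym same)
...   | inj₂ f≤p₁ | _         = inj₁ (inside-false (inj₂ (<⇒≤ (≤-<-trans f≤p₁ p₁<w))))
...   | inj₁ _    | inj₁ p₂≤e = inj₁ (inside-false (inj₁ (<⇒≤ (<-≤-trans w<p₂ p₂≤e))))
...   | inj₁ p₁≤e | inj₂ f≤p₂ = inj₂ (≤∧≢⇒< p₁≤e p₁≢e , ≤∧≢⇒< f≤p₂ (p₂≢f ∘ sym))

enclosed-outside : ∀ {e f p₁ p₂ w} → Encloses p₁ p₂ e f → w ≤ p₁ ⊎ p₂ ≤ w → inside e f w ≡ false
enclosed-outside (p₁<e , _) (inj₁ w≤p₁) = inside-false (inj₁ (<⇒≤ (≤-<-trans w≤p₁ p₁<e)))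
enclosed-outside (_ , f<p₂) (inj₂ p₂≤w) = inside-false (inj₂ (<⇒≤ (<-≤-trans f<p₂ p₂≤w)))

crossing-enclosed : ∀ {c₁ c₂ d₁ d₂ p₁ p₂} → Interleaved c₁ c₂ d₁ d₂ → inside d₁ d₂ p₁ ≡ inside d₁ d₂ p₂ →
  Avoids d₁ d₂ p₁ → Avoids d₁ d₂ p₂ → Encloses p₁ p₂ c₁ c₂ → Encloses p₁ p₂ d₁ d₂
crossing-enclosed (inj₁ (c₁<d₁ , d₁<c₂ , _)) same _ (_ , p₂≢d₂) (p₁<c₁ , c₂<p₂)
  with inside-false⁻ (trans (sym same) (inside-false (inj₁ (<⇒≤ (<-trans p₁<c₁ c₁<d₁)))))
... | inj₁ p₂≤d₁ = ⊥-elim (<⇒≱ (<-trans d₁<c₂ c₂<p₂) p₂≤d₁)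
... | inj₂ d₂≤p₂ = <-trans p₁<c₁ c₁<d₁ , ≤∧≢⇒< d₂≤p₂ (p₂≢d₂ ∘ sym)
crossing-enclosed (inj₂ (_ , c₁<d₂ , d₂<c₂)) same (p₁≢d₁ , _) _ (p₁<c₁ , c₂<p₂)
  with inside-false⁻ (trans same (inside-false (inj₂ (<⇒≤ (<-trans d₂<c₂ c₂<p₂)))))
... | inj₂ d₂≤p₁ = ⊥-elim (<⇒≱ (<-trans p₁<c₁ c₁<d₂) d₂≤p₁)
... | inj₁ p₁≤d₁ = ≤∧≢⇒< p₁≤d₁ p₁≢d₁ , <-trans d₂<c₂ c₂<p₂

module Quadrants (c₁ c₂ d₁ d₂ : ℕ) where

  quadrant : ℕ → Bool × Bool
  quadrant q = inside c₁ c₂ q , inside d₁ d₂ q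

  AvoidsBoth : ℕ → Set
  AvoidsBoth q = Avoids c₁ c₂ q × Avoids d₁ d₂ q

  Meets : ℕ → ℕ → Bool × Bool → Set
  Meets a b r = quadrant a ≡ r ⊎ quadrant b ≡ r

  uncrossed-quadrant : ∀ {p₁ p₂} → p₁ < p₂ → ¬ Interleaved p₁ p₂ c₁ c₂ → ¬ Interleaved p₁ p₂ d₁ d₂ →
    AvoidsBoth p₁ → AvoidsBoth p₂ → quadrant p₁ ≡ quadrant p₂
  uncrossed-quadrant p₁<p₂ ¬c ¬d (c₁ₐ , d₁ₐ) (c₂ₐ , d₂ₐ) =
    cong₂ _,_ (inside-uncrossed p₁<p₂ ¬c c₁ₐ c₂ₐ) (inside-uncrossed p₁<p₂ ¬d d₁ₐ d₂ₐ)

  enclosed-quadrant : ∀ {p₁ p₂ o} → Encloses p₁ p₂ c₁ c₂ → Encloses p₁ p₂ d₁ d₂ → o ≤ p₁ ⊎ p₂ ≤ o →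
    quadrant o ≡ quadrant p₁
  enclosed-quadrant Eᶜ Eᵈ o-out = cong₂ _,_
    (trans (enclosed-outside Eᶜ o-out) (sym (enclosed-outside Eᶜ (inj₁ ≤-refl))))
    (trans (enclosed-outside Eᵈ o-out) (sym (enclosed-outside Eᵈ (inj₁ ≤-refl))))

  between-or-outside : ∀ {p₁ p₂ w o} → Interleaved c₁ c₂ d₁ d₂ → p₁ < w → w < p₂ → o ≤ p₁ ⊎ p₂ ≤ o →
    quadrant p₁ ≡ quadrant p₂ → AvoidsBoth p₁ → AvoidsBoth p₂ →
    quadrant w ≡ quadrant p₁ ⊎ quadrant o ≡ quadrant p₁
  between-or-outside cd p₁<w w<p₂ o-out same (c₁ₐ , d₁ₐ) (c₂ₐ , d₂ₐ)
    with inside-between p₁<w w<p₂ (cong proj₁ same) c₁ₐ c₂ₐ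
       | inside-between p₁<w w<p₂ (cong proj₂ same) d₁ₐ d₂ₐ
  ... | inj₁ sameᶜ | inj₁ sameᵈ = inj₁ (cong₂ _,_ sameᶜ sameᵈ)
  ... | inj₂ Eᶜ    | _          =
    inj₂ (enclosed-quadrant Eᶜ (crossing-enclosed cd (cong proj₂ same) d₁ₐ d₂ₐ Eᶜ) o-out)
  ... | inj₁ _     | inj₂ Eᵈ    =
    inj₂ (enclosed-quadrant (crossing-enclosed (Interleaved-sym cd) (cong proj₁ same) c₁ₐ c₂ₐ Eᵈ) Eᵈ o-out)

  crossing-meets : ∀ {p₁ p₂ z₁ z₂} → Interleaved c₁ c₂ d₁ d₂ → quadrant p₁ ≡ quadrant p₂ →
    AvoidsBoth p₁ → AvoidsBoth p₂ → Interleaved p₁ p₂ z₁ z₂ → Meets z₁ z₂ (quadrant p₁)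
  crossing-meets cd same a₁ a₂ (inj₁ (p₁<z₁ , z₁<p₂ , p₂<z₂)) =
    between-or-outside cd p₁<z₁ z₁<p₂ (inj₂ (<⇒≤ p₂<z₂)) same a₁ a₂
  crossing-meets cd same a₁ a₂ (inj₂ (z₁<p₁ , p₁<z₂ , z₂<p₂)) =
    Sum.swap (between-or-outside cd p₁<z₂ z₂<p₂ (inj₁ (<⇒≤ z₁<p₁)) same a₁ a₂)

disjoint-pairs : ∀ {A : Set} {x₁ x₂ y₁ y₂ : A} → x₁ ≢ y₁ → x₁ ≢ y₂ → x₂ ≢ y₁ → x₂ ≢ y₂ →
  ∀ r → x₁ ≡ r ⊎ x₂ ≡ r → y₁ ≡ r ⊎ y₂ ≡ r → ⊥
disjoint-pairs x₁≢y₁ _ _ _ r (inj₁ refl) (inj₁ y₁≡) = x₁≢y₁ (sym y₁≡)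
disjoint-pairs _ x₁≢y₂ _ _ r (inj₁ refl) (inj₂ y₂≡) = x₁≢y₂ (sym y₂≡)
disjoint-pairs _ _ x₂≢y₁ _ r (inj₂ refl) (inj₁ y₁≡) = x₂≢y₁ (sym y₁≡)
disjoint-pairs _ _ _ x₂≢y₂ r (inj₂ refl) (inj₂ y₂≡) = x₂≢y₂ (sym y₂≡)

≢-by : ∀ {A : Set} {x y v w : A} → x ≡ v → y ≡ w → v ≢ w → x ≢ y
≢-by refl refl v≢w = v≢w

-- The cyclic pattern a₁ c₁ a₂ d₁ b₁ c₂ b₂ d₂, cut into a word in the two ways that arise below.
module _ {a₁ b₁ a₂ b₂ c₁ c₂ d₁ d₂ : ℕ} where
  open Quadrants c₁ c₂ d₁ d₂

  apart-inner : a₁ < c₁ → c₁ < a₂ → a₂ < d₁ → d₁ < b₁ → b₁ < c₂ → c₂ < b₂ → b₂ < d₂ →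
    ∀ r → Meets a₁ b₁ r → Meets a₂ b₂ r → ⊥
  apart-inner a₁<c₁ c₁<a₂ a₂<d₁ d₁<b₁ b₁<c₂ c₂<b₂ b₂<d₂ =
    disjoint-pairs (≢-by qa₁ qa₂ λ ()) (≢-by qa₁ qb₂ λ ()) (≢-by qb₁ qa₂ λ ()) (≢-by qb₁ qb₂ λ ())
    where
    c₁<b₁ = <-trans c₁<a₂ (<-trans a₂<d₁ d₁<b₁)
    qa₁ : quadrant a₁ ≡ (false , false)
    qa₁ = cong₂ _,_ (inside-false (inj₁ (<⇒≤ a₁<c₁))) (inside-false (inj₁ (<⇒≤ (<-trans a₁<c₁ (<-trans c₁<a₂ a₂<d₁)))))
    qb₁ : quadrant b₁ ≡ (true , true)
    qb₁ = cong₂ _,_ (inside-true c₁<b₁ b₁<c₂) (inside-true d₁<b₁ (<-trans b₁<c₂ (<-trans c₂<b₂ b₂<d₂)))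
    qa₂ : quadrant a₂ ≡ (true , false)
    qa₂ = cong₂ _,_ (inside-true c₁<a₂ (<-trans a₂<d₁ (<-trans d₁<b₁ b₁<c₂))) (inside-false (inj₁ (<⇒≤ a₂<d₁)))
    qb₂ : quadrant b₂ ≡ (false , true)
    qb₂ = cong₂ _,_ (inside-false (inj₂ (<⇒≤ c₂<b₂))) (inside-true (<-trans d₁<b₁ (<-trans b₁<c₂ c₂<b₂)) b₂<d₂)

  apart-outer : d₁ < a₁ → a₁ < c₁ → c₁ < a₂ → a₂ < d₂ → d₂ < b₁ → b₁ < c₂ → c₂ < b₂ →
    ∀ r → Meets a₁ b₁ r → Meets a₂ b₂ r → ⊥
  apart-outer d₁<a₁ a₁<c₁ c₁<a₂ a₂<d₂ d₂<b₁ b₁<c₂ c₂<b₂ =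
    disjoint-pairs (≢-by qa₁ qa₂ λ ()) (≢-by qa₁ qb₂ λ ()) (≢-by qb₁ qa₂ λ ()) (≢-by qb₁ qb₂ λ ())
    where
    qa₁ : quadrant a₁ ≡ (false , true)
    qa₁ = cong₂ _,_ (inside-false (inj₁ (<⇒≤ a₁<c₁))) (inside-true d₁<a₁ (<-trans a₁<c₁ (<-trans c₁<a₂ a₂<d₂)))
    qb₁ : quadrant b₁ ≡ (true , false)
    qb₁ = cong₂ _,_ (inside-true (<-trans c₁<a₂ (<-trans a₂<d₂ d₂<b₁)) b₁<c₂) (inside-false (inj₂ (<⇒≤ d₂<b₁)))
    qa₂ : quadrant a₂ ≡ (true , true)
    qa₂ = cong₂ _,_ (inside-true c₁<a₂ (<-trans a₂<d₂ (<-trans d₂<b₁ b₁<c₂)))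
      (inside-true (<-trans d₁<a₁ (<-trans a₁<c₁ c₁<a₂)) a₂<d₂)
    qb₂ : quadrant b₂ ≡ (false , false)
    qb₂ = cong₂ _,_ (inside-false (inj₂ (<⇒≤ c₂<b₂))) (inside-false (inj₂ (<⇒≤ (<-trans d₂<b₁ (<-trans b₁<c₂ c₂<b₂)))))

-- Splits in a circle representation

A⇒¬B : ∀ {P} → P ≡ pA → P ≢ pB
A⇒¬B refl ()

sA⇒¬B : ∀ {P} → P ≡ psA → P ≢ pB
sA⇒¬B refl ()

Adj⇒≢ : ∀ {n} (G : Graph n) {u v} → Adj G u v → u ≢ v
Adj⇒≢ G a refl = irrefl G a

module _ {n} {G : Graph n} (S : Split G) where

  AB : Fin n → Set
  AB v = part S v ≡ pA ⊎ part S v ≡ pB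

  Opposite : Fin n → Fin n → Set
  Opposite u v = (part S u ≡ pA × part S v ≡ pB) ⊎ (part S u ≡ pB × part S v ≡ pA)

  Opposite-sym : ∀ {u v} → Opposite u v → Opposite v u
  Opposite-sym (inj₁ (uA , vB)) = inj₂ (vB , uA)
  Opposite-sym (inj₂ (uB , vA)) = inj₁ (vA , uB)

  Opposite⇒≢ : ∀ {u v} → Opposite u v → u ≢ v
  Opposite⇒≢ (inj₁ (uA , vB)) refl = A⇒¬B uA vB
  Opposite⇒≢ (inj₂ (uB , vA)) refl = A⇒¬B vA uB

  Opposite⇒Adj : ∀ {u v} → Opposite u v → Adj G u v
  Opposite⇒Adj (inj₁ (uA , vB)) = A-B S _ _ uA vB
  Opposite⇒Adj (inj₂ (uB , vA)) = symm G (A-B S _ _ vA uB)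

  Opposite⇒AB : ∀ {u v} → Opposite u v → AB u
  Opposite⇒AB (inj₁ (uA , _)) = inj₁ uA
  Opposite⇒AB (inj₂ (uB , _)) = inj₂ uB

  A-opposite⇒B : ∀ {u v} → part S u ≡ pA → Opposite u v → part S v ≡ pB
  A-opposite⇒B _  (inj₁ (_ , vB))  = vB
  A-opposite⇒B uA (inj₂ (uB , _)) = ⊥-elim (A⇒¬B uA uB)

  AB⇒isAB : ∀ {v} → AB v → isAB (part S v) ≡ true
  AB⇒isAB (inj₁ vA) rewrite vA = refl
  AB⇒isAB (inj₂ vB) rewrite vB = refl

-- τ is the word of a circle representation of G, cut so that the blocks of D, read from index 0, spell out
-- its subword on A ∪ B.
module SplitInWord {n : ℕ} (G : Graph n) (S : Split G) (τ : List (Fin n))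
  (twice : ∀ v → count v τ ≡ 2)
  (adj⇔alt : ∀ u v → u ≢ v → Adj G u v ⇔ Alt τ u v)
  (k₀ : ℕ) {γ : List (Fin n)} (D : Decomposition S γ (suc k₀))
  (τ-blocks : filterᵇ (isAB ∘ part S) τ ≡ concat (map (block D) (upTo (suc k₀ + suc k₀))))
  where

  open Occurrences
  open Equivalence

  blk : ℕ → List (Fin n)
  blk = block D

  k K′ K : ℕ
  k  = suc k₀
  K′ = k₀ + k
  K  = suc K′

  occ : ∀ v → Occurrences τ v
  occ v = count≡2⇒occurrences τ (twice v)

  left right : Fin n → ℕ
  left v  = first (occ v)
  right v = second (occ v)

  Crosses : Fin n → Fin n → Set
  Crosses u v = Interleaved (left u) (right u) (left v) (right v)

  adj⇔crosses : ∀ {u v} → u ≢ v → Adj G u v ⇔ Crosses u v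
  adj⇔crosses {u} {v} u≢v = Alt⇔Interleaved (occ u) (occ v) ⇔-∘ adj⇔alt u v u≢v

  blocks≡ : filterᵇ (isAB ∘ part S) τ ≡ concat (applyUpTo blk K)
  blocks≡ = trans τ-blocks (cong concat (map-applyUpTo id blk K))

  blockOf : ℕ → ℕ
  blockOf q = blockIndex blk K (filteredIndex (isAB ∘ part S) τ q)

  blockOf-∈ : ∀ {q v} → τ [ q ]= v → AB S v → blockOf q < K × v ∈ blk (blockOf q)
  blockOf-∈ a v∈AB = blockIndex-∈ blk K
    (subst (_[ _ ]= _) blocks≡ (filteredIndex-[]= (isAB ∘ part S) τ a (AB⇒isAB S v∈AB)))

  blockOf-mono : ∀ {q q′} → q ≤ q′ → blockOf q ≤ blockOf q′
  blockOf-mono q≤ = blockIndex-mono blk K (filteredIndex-mono (isAB ∘ part S) τ q≤)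

  blockOf-surjective : ∀ {v t} → v ∈ blk t → t < K → ∃[ q ] (τ [ q ]= v × blockOf q ≡ t)
  blockOf-surjective v∈ t< with blockIndex-surjective blk K v∈ t<
  ... | g , a , refl with filteredIndex-surjective (isAB ∘ part S) τ (subst (_[ g ]= _) (sym blocks≡) a)
  ...   | q , b , refl = q , b , refl

  blk-AB : ∀ {v t} → v ∈ blk t → AB S v
  blk-AB {t = t} v∈ with alternate D t
  ... | inj₁ (allA , _) = inj₁ (All-lookup allA v∈)
  ... | inj₂ (allB , _) = inj₂ (All-lookup allB v∈)

  next-blk-opposite : ∀ {u v t} → u ∈ blk t → v ∈ blk (suc t) → Opposite S u v
  next-blk-opposite {t = t} u∈ v∈ with alternate D t
  ... | inj₁ (allA , allB) = inj₁ (All-lookup allA u∈ , All-lookup allB v∈)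
  ... | inj₂ (allB , allA) = inj₂ (All-lookup allB u∈ , All-lookup allA v∈)

  same-blk-not-opposite : ∀ {u v t} → u ∈ blk t → v ∈ blk t → ¬ Opposite S u v
  same-blk-not-opposite {t = t} u∈ v∈ opp with alternate D t | opp
  ... | inj₁ (allA , _) | inj₁ (_ , vB) = A⇒¬B (All-lookup allA v∈) vB
  ... | inj₁ (allA , _) | inj₂ (uB , _) = A⇒¬B (All-lookup allA u∈) uB
  ... | inj₂ (allB , _) | inj₁ (uA , _) = A⇒¬B uA (All-lookup allB u∈)
  ... | inj₂ (allB , _) | inj₂ (_ , vA) = A⇒¬B vA (All-lookup allB v∈)

  some-member : ∀ t → ∃[ v ] v ∈ blk t
  some-member t with blk t | nonempty D t
  ... | []    | ≢[] = ⊥-elim (≢[] refl)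
  ... | v ∷ _ | _   = v , here refl

  module _ {u v p q} (opp : Opposite S u v) (aₚ : τ [ p ]= u) (a_q : τ [ q ]= v) where

    opposite-blocks-differ : blockOf p ≢ blockOf q
    opposite-blocks-differ eq = same-blk-not-opposite
      (proj₂ (blockOf-∈ aₚ (Opposite⇒AB S opp)))
      (subst (λ t → v ∈ blk t) (sym eq) (proj₂ (blockOf-∈ a_q (Opposite⇒AB S (Opposite-sym S opp)))))
      opp

    opposite-< : blockOf p ≤ blockOf q → p < q
    opposite-< b≤ with <-cmp p q
    ... | tri< p<q _ _ = p<q
    ... | tri≈ _ refl _ = ⊥-elim (Opposite⇒≢ S opp ([]=-functional aₚ a_q))
    ... | tri> _ _ q<p = ⊥-elim (opposite-blocks-differ (≤-antisym b≤ (blockOf-mono (<⇒≤ q<p))))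

    opposite-blk-< : p < q → blockOf p < blockOf q
    opposite-blk-< p<q = ≤∧≢⇒< (blockOf-mono (<⇒≤ p<q)) opposite-blocks-differ

  lo hi : Fin n → ℕ
  lo v = blockOf (left v)
  hi v = blockOf (right v)

  lo-∈ : ∀ {v} → AB S v → v ∈ blk (lo v)
  lo-∈ {v} v∈AB = proj₂ (blockOf-∈ (at-first (occ v)) v∈AB)

  hi-∈ : ∀ {v} → AB S v → v ∈ blk (hi v)
  hi-∈ {v} v∈AB = proj₂ (blockOf-∈ (at-second (occ v)) v∈AB)

  touches⇒∈ : ∀ {v t} → AB S v → Touches lo hi v t → v ∈ blk t
  touches⇒∈ v∈AB (inj₁ refl) = lo-∈ v∈AB
  touches⇒∈ v∈AB (inj₂ refl) = hi-∈ v∈AB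

  ∈⇒touches : ∀ {v t} → v ∈ blk t → t < K → Touches lo hi v t
  ∈⇒touches {v} v∈ t< with blockOf-surjective v∈ t<
  ... | q , a , refl with only (occ v) a
  ...   | inj₁ refl = inj₁ refl
  ...   | inj₂ refl = inj₂ refl

  opposite-interleaved : ∀ {u v} → Opposite S u v → Interleaved (lo u) (hi u) (lo v) (hi v)
  opposite-interleaved {u} {v} opp with to (adj⇔crosses (Opposite⇒≢ S opp)) (Opposite⇒Adj S opp)
  ... | inj₁ (uₗ<vₗ , vₗ<uᵣ , uᵣ<vᵣ) =
    inj₁ (opposite-blk-< opp (at-first (occ u)) (at-first (occ v)) uₗ<vₗ ,
          opposite-blk-< opp′ (at-first (occ v)) (at-second (occ u)) vₗ<uᵣ ,
          opposite-blk-< opp (at-second (occ u)) (at-second (occ v)) uᵣ<vᵣ)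
    where opp′ = Opposite-sym S opp
  ... | inj₂ (vₗ<uₗ , uₗ<vᵣ , vᵣ<uᵣ) =
    inj₂ (opposite-blk-< opp′ (at-first (occ v)) (at-first (occ u)) vₗ<uₗ ,
          opposite-blk-< opp (at-first (occ u)) (at-second (occ v)) uₗ<vᵣ ,
          opposite-blk-< opp′ (at-second (occ v)) (at-second (occ u)) vᵣ<uᵣ)
    where opp′ = Opposite-sym S opp

  open Diameters (AB S) lo hi k K′ refl
    (λ {v} _ → blockOf-mono (<⇒≤ (first<second (occ v))))
    (λ {v} v∈AB → proj₁ (blockOf-∈ (at-second (occ v)) v∈AB))
    (proj₁ ∘ some-member) (λ t _ → blk-AB (proj₂ (some-member t))) (λ t → ∈⇒touches (proj₂ (some-member t)))
    (λ u∈AB v∈AB _ tu tv → opposite-interleaved (next-blk-opposite (touches⇒∈ u∈AB tu) (touches⇒∈ v∈AB tv)))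
    (λ u∈AB v∈AB tu tv → opposite-interleaved
       (next-blk-opposite (touches⇒∈ u∈AB tu) (subst (_ ∈_) (sym (periodic D 0)) (touches⇒∈ v∈AB tv))))
    using (diameter)

  at-left : ∀ v → τ [ left v ]= v
  at-left v = at-first (occ v)

  at-right : ∀ v → τ [ right v ]= v
  at-right v = at-second (occ v)

  ordered-by-blocks : ∀ {x y p q s t} → Opposite S x y → τ [ p ]= x → τ [ q ]= y →
    blockOf p ≡ s → blockOf q ≡ t → s ≤ t → p < q
  ordered-by-blocks opp aₚ a_q refl refl = opposite-< opp aₚ a_q

  ChordMeets : Fin n → Fin n → Fin n → Bool × Bool → Set
  ChordMeets c d v = Quadrants.Meets (left c) (right c) (left d) (right d) (left v) (right v)

  record Separation (u w : Fin n) : Set where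
    field
      c d   : Fin n
      c∈B   : part S c ≡ pB
      d∈B   : part S d ≡ pB
      c×d   : Crosses c d
      apart : ∀ r → ChordMeets c d u r → ChordMeets c d w r → ⊥

  -- c and d are the first letters of the blocks following those of u and w.
  module _ {u w} (uA : part S u ≡ pA) (wA : part S w ≡ pA) (lo-u<lo-w : lo u < lo w) where

    private
      hi-u : hi u ≡ lo u + k
      hi-u = diameter (inj₁ uA)

      hi-w : hi w ≡ lo w + k
      hi-w = diameter (inj₁ wA)

      lo-w<k : lo w < k
      lo-w<k = +-cancelʳ-< k (lo w) k (subst (_< k + k) hi-w (proj₁ (blockOf-∈ (at-right w) (inj₁ wA))))

      suc-lo-w<K : suc (lo w) < K
      suc-lo-w<K = s≤s (<-≤-trans lo-w<k (m≤n+m k k₀))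

      c d : Fin n
      c = proj₁ (some-member (suc (lo u)))
      d = proj₁ (some-member (suc (lo w)))

      c∈ : c ∈ blk (suc (lo u))
      c∈ = proj₂ (some-member (suc (lo u)))

      d∈ : d ∈ blk (suc (lo w))
      d∈ = proj₂ (some-member (suc (lo w)))

      c∈B : part S c ≡ pB
      c∈B = A-opposite⇒B S uA (next-blk-opposite (lo-∈ (inj₁ uA)) c∈)

      d∈B : part S d ≡ pB
      d∈B = A-opposite⇒B S wA (next-blk-opposite (lo-∈ (inj₁ wA)) d∈)

      lo-c : lo c ≡ suc (lo u)
      lo-c with ∈⇒touches c∈ (<-trans (s≤s lo-u<lo-w) suc-lo-w<K)
      ... | inj₁ lo-c = lo-c
      ... | inj₂ hi-c = ⊥-elim (<-irrefl refl (<-≤-trans lo-w<k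
              (≤-trans (m≤n+m k (lo c)) (≤-trans (≤-reflexive (trans (sym (diameter (inj₂ c∈B))) hi-c)) lo-u<lo-w))))

      hi-c : hi c ≡ suc (lo u) + k
      hi-c = trans (diameter (inj₂ c∈B)) (cong (_+ k) lo-c)

      uₗ<cₗ : left u < left c
      uₗ<cₗ = ordered-by-blocks (inj₁ (uA , c∈B)) (at-left u) (at-left c) refl lo-c (n≤1+n (lo u))

      cₗ<wₗ : left c < left w
      cₗ<wₗ = ordered-by-blocks (inj₂ (c∈B , wA)) (at-left c) (at-left w) lo-c refl lo-u<lo-w

      uᵣ<cᵣ : right u < right c
      uᵣ<cᵣ = ordered-by-blocks (inj₁ (uA , c∈B)) (at-right u) (at-right c) hi-u hi-c (n≤1+n (lo u + k))

      cᵣ<wᵣ : right c < right w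
      cᵣ<wᵣ = ordered-by-blocks (inj₂ (c∈B , wA)) (at-right c) (at-right w) hi-c hi-w (+-monoˡ-≤ k lo-u<lo-w)

      inner-separation : lo d ≡ suc (lo w) → Separation u w
      inner-separation lo-d = record
        { c = c ; d = d ; c∈B = c∈B ; d∈B = d∈B
        ; c×d = inj₁ (<-trans cₗ<wₗ wₗ<dₗ , <-trans dₗ<uᵣ uᵣ<cᵣ , <-trans cᵣ<wᵣ wᵣ<dᵣ)
        ; apart = apart-inner uₗ<cₗ cₗ<wₗ wₗ<dₗ dₗ<uᵣ uᵣ<cᵣ cᵣ<wᵣ wᵣ<dᵣ
        }
        where
        hi-d : hi d ≡ suc (lo w) + k
        hi-d = trans (diameter (inj₂ d∈B)) (cong (_+ k) lo-d)
        wₗ<dₗ : left w < left d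
        wₗ<dₗ = ordered-by-blocks (inj₁ (wA , d∈B)) (at-left w) (at-left d) refl lo-d (n≤1+n (lo w))
        dₗ<uᵣ : left d < right u
        dₗ<uᵣ = ordered-by-blocks (inj₂ (d∈B , uA)) (at-left d) (at-right u) lo-d hi-u (≤-trans lo-w<k (m≤n+m k (lo u)))
        wᵣ<dᵣ : right w < right d
        wᵣ<dᵣ = ordered-by-blocks (inj₁ (wA , d∈B)) (at-right w) (at-right d) hi-w hi-d (n≤1+n (lo w + k))

      outer-separation : hi d ≡ suc (lo w) → Separation u w
      outer-separation hi-d′ = record
        { c = c ; d = d ; c∈B = c∈B ; d∈B = d∈B
        ; c×d = inj₂ (<-trans dₗ<uₗ uₗ<cₗ , <-trans cₗ<wₗ wₗ<dᵣ , <-trans dᵣ<uᵣ uᵣ<cᵣ)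
        ; apart = apart-outer dₗ<uₗ uₗ<cₗ cₗ<wₗ wₗ<dᵣ dᵣ<uᵣ uᵣ<cᵣ cᵣ<wᵣ
        }
        where
        lo-d : lo d ≡ 0
        lo-d = n≤0⇒n≡0 (+-cancelʳ-≤ k (lo d) 0
                 (≤-trans (≤-reflexive (trans (sym (diameter (inj₂ d∈B))) hi-d′)) lo-w<k))
        hi-d : hi d ≡ k
        hi-d = trans (diameter (inj₂ d∈B)) (cong (_+ k) lo-d)
        dₗ<uₗ : left d < left u
        dₗ<uₗ = ordered-by-blocks (inj₂ (d∈B , uA)) (at-left d) (at-left u) lo-d refl z≤n
        wₗ<dᵣ : left w < right d
        wₗ<dᵣ = ordered-by-blocks (inj₁ (wA , d∈B)) (at-left w) (at-right d) refl hi-d (<⇒≤ lo-w<k)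
        dᵣ<uᵣ : right d < right u
        dᵣ<uᵣ = ordered-by-blocks (inj₂ (d∈B , uA)) (at-right d) (at-right u) hi-d hi-u (m≤n+m k (lo u))

    separation : Separation u w
    separation with ∈⇒touches d∈ suc-lo-w<K
    ... | inj₁ lo-d = inner-separation lo-d
    ... | inj₂ hi-d = outer-separation hi-d

  module ThroughSA {c d} (c∈B : part S c ≡ pB) (d∈B : part S d ≡ pB) (c×d : Crosses c d) where
    open Quadrants (left c) (right c) (left d) (right d)

    avoids : ∀ {z q} → part S z ≢ pB → τ [ q ]= z → AvoidsBoth q
    avoids {z} {q} z∉B a = (off c∈B (at-left c) , off c∈B (at-right c)) , (off d∈B (at-left d) , off d∈B (at-right d))
      where
      off : ∀ {b p} → part S b ≡ pB → τ [ p ]= b → q ≢ p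
      off bB aₚ refl = z∉B (trans (cong (part S) ([]=-functional a aₚ)) bB)

    sA-uncrossed : ∀ {p b} → part S p ≡ psA → part S b ≡ pB → ¬ Crosses p b
    sA-uncrossed {p} {b} p∈sA bB p×b = sA-Bs S p b p∈sA (inj₁ bB) (from (adj⇔crosses p≢b) p×b)
      where
      p≢b : p ≢ b
      p≢b refl = sA⇒¬B p∈sA bB

    sA-within-quadrant : ∀ {p} → part S p ≡ psA → quadrant (left p) ≡ quadrant (right p)
    sA-within-quadrant {p} p∈sA = uncrossed-quadrant (first<second (occ p))
      (sA-uncrossed p∈sA c∈B) (sA-uncrossed p∈sA d∈B)
      (avoids (sA⇒¬B p∈sA) (at-left p)) (avoids (sA⇒¬B p∈sA) (at-right p))

    sA-meets : ∀ {p r} → part S p ≡ psA → ChordMeets c d p r → quadrant (left p) ≡ r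
    sA-meets p∈sA (inj₁ ≡r) = ≡r
    sA-meets p∈sA (inj₂ ≡r) = trans (sA-within-quadrant p∈sA) ≡r

    neighbour-of-sA-meets : ∀ {p z} → part S p ≡ psA → part S z ≢ pB → Adj G p z →
      ChordMeets c d z (quadrant (left p))
    neighbour-of-sA-meets {p} {z} p∈sA z∉B a = crossing-meets c×d (sA-within-quadrant p∈sA)
      (avoids (sA⇒¬B p∈sA) (at-left p)) (avoids (sA⇒¬B p∈sA) (at-right p))
      (to (adj⇔crosses (Adj⇒≢ G a)) a)

    walk-through-sA-meets : ∀ {z} ps {y} → part S z ≡ psA → All (λ v → part S v ≡ psA) ps → part S y ≢ pB →
      Walk G (z ∷ ps ++ y ∷ []) → ChordMeets c d y (quadrant (left z))
    walk-through-sA-meets []       z∈sA []              y∉B (step a (single _)) = neighbour-of-sA-meets z∈sA y∉B a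
    walk-through-sA-meets (p ∷ ps) z∈sA (p∈sA ∷ ps∈sA) y∉B (step a walk) =
      subst (ChordMeets c d _) (sA-meets p∈sA (neighbour-of-sA-meets z∈sA (sA⇒¬B p∈sA) a))
        (walk-through-sA-meets ps p∈sA ps∈sA y∉B walk)

    path-through-sA-common-quadrant : ∀ {x y} p ps → part S x ≢ pB → part S y ≢ pB →
      All (λ v → part S v ≡ psA) (p ∷ ps) → Walk G (x ∷ (p ∷ ps) ++ y ∷ []) →
      ∃[ r ] (ChordMeets c d x r × ChordMeets c d y r)
    path-through-sA-common-quadrant p ps x∉B y∉B (p∈sA ∷ ps∈sA) (step a walk) =
      quadrant (left p) , neighbour-of-sA-meets p∈sA x∉B (symm G a) , walk-through-sA-meets ps p∈sA ps∈sA y∉B walk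

  Separation-sym : ∀ {u w} → Separation u w → Separation w u
  Separation-sym sep = record { Separation sep ; apart = λ r w-meets u-meets → apart r u-meets w-meets }
    where open Separation sep

  not-separated : ∀ {u w} p ps → part S u ≢ pB → part S w ≢ pB → All (λ v → part S v ≡ psA) (p ∷ ps) →
    Walk G (u ∷ (p ∷ ps) ++ w ∷ []) → ¬ Separation u w
  not-separated p ps u∉B w∉B ps∈sA walk sep =
    let r , u-meets , w-meets = ThroughSA.path-through-sA-common-quadrant c∈B d∈B c×d p ps u∉B w∉B ps∈sA walk
    in apart r u-meets w-meets
    where open Separation sep

  same-blocks : ∀ {x y} → part S x ≡ pA → part S y ≡ pA → ∀ p ps → All (λ v → part S v ≡ psA) (p ∷ ps) →
    Walk G (x ∷ (p ∷ ps) ++ y ∷ []) → ∃[ i ] (x ∈ blk i × y ∈ blk i × x ∈ blk (i + k) × y ∈ blk (i + k))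
  same-blocks {x} {y} xA yA p ps ps∈sA walk with <-cmp (lo x) (lo y)
  ... | tri< lo-x<lo-y _ _ =
    ⊥-elim (not-separated p ps (A⇒¬B xA) (A⇒¬B yA) ps∈sA walk (separation xA yA lo-x<lo-y))
  ... | tri> _ _ lo-y<lo-x =
    ⊥-elim (not-separated p ps (A⇒¬B xA) (A⇒¬B yA) ps∈sA walk (Separation-sym (separation yA xA lo-y<lo-x)))
  ... | tri≈ _ lo-x≡lo-y _ =
    lo x , lo-∈ (inj₁ xA) , subst (λ t → y ∈ blk t) (sym lo-x≡lo-y) (lo-∈ (inj₁ yA)) ,
    subst (λ t → x ∈ blk t) (diameter (inj₁ xA)) (hi-∈ (inj₁ xA)) ,
    subst (λ t → y ∈ blk t) (trans (diameter (inj₁ yA)) (cong (_+ k) (sym lo-x≡lo-y))) (hi-∈ (inj₁ yA))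

module _ {n} {G : Graph n} (R : CircleRep G) where

  rotated-twice : ∀ m v → count v (rotate m (word R)) ≡ 2
  rotated-twice m v = trans (count-rotate v m (word R)) (twice R v)

  rotated-adj⇔alt : ∀ {m} → m ≤ length (word R) → ∀ u v → u ≢ v → Adj G u v ⇔ Alt (rotate m (word R)) u v
  rotated-adj⇔alt {m} m≤ u v u≢v = Alt-rotate m (word R) m≤ ⇔-∘ (Alternate⇔Alt ⇔-∘ adj⇔alt R u v u≢v)

  rotated-blocks : ∀ (S : Split G) {k} (D : Decomposition S (gamma S (word R)) k) →
    ∃[ m ] (m ≤ length (word R) × filterᵇ (isAB ∘ part S) (rotate m (word R)) ≡ concat (map (block D) (upTo (k + k))))
  rotated-blocks S D with covers D
  ... | j , γ-blocks with rotate-filterᵇ-lift (isAB ∘ part S) (word R) j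
  ...   | m , m≤ , lifted = m , m≤ , trans lifted γ-blocks

mainTheorem2 : ∀ {n} (G : Graph n) → Connected G → IsCircleGraph G →
    (S : Split G) (x y : Fin n) → part S x ≡ pA → part S y ≡ pA →
    (int : List (Fin n)) → int ≢ [] → All (λ v → part S v ≡ psA) int →
    IsPath G x y int →
    (R : CircleRep G) (k : ℕ) (D : Decomposition S (gamma S (word R)) k) →
    ∃[ i ] (x ∈ block D i × y ∈ block D i × x ∈ block D (i + k) × y ∈ block D (i + k))
mainTheorem2 _ _ _ _ _ _ _ _ [] int≢[] _ _ _ _ _ = ⊥-elim (int≢[] refl)
mainTheorem2 G _ _ S x y xA yA (p ∷ ps) _ _ _ R zero D with rotated-blocks R S D
... | m , _ , τ-blocks = ⊥-elim (filterᵇ-≢[] (isAB ∘ part S) (rotate m (word R))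
  (Occurrences.at-first (count≡2⇒occurrences _ (rotated-twice R m x))) (AB⇒isAB S (inj₁ xA)) τ-blocks)
mainTheorem2 G _ _ S x y xA yA (p ∷ ps) _ int∈sA (walk , _) R (suc k₀) D with rotated-blocks R S D
... | m , m≤ , τ-blocks = SplitInWord.same-blocks G S (rotate m (word R)) (rotated-twice R m) (rotated-adj⇔alt R m≤)
  k₀ D τ-blocks xA yA p ps int∈sA walk
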